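{- Let $n\ge 0$. If $n$ is even and $w\in F_{\mathrm{odd}}(n)$, then $w^+\cap F_{\mathrm{odd}}(n+1)=\{1w\}$. If $n$ is odd and $w\in F_{\mathrm{odd}}(n)$, then $w=1v$ for a unique $v\in F_{\mathrm{odd}}(n-1)$, and $w^+\cap F_{\mathrm{odd}}(n+1)=\{11v,\,2v\}$. Consequently, the subgraph $F_{\mathrm{odd}}$ of the Young–Fibonacci graph induced by the odd words is a binary tree (rooted at $\emptyset$) in which every node of even rank has exactly one child and every node of odd rank has exactly two children.
   Context: For $n\ge 0$, let $F(n)$ be the set of all words $w=x_1\dotsb x_l$ with each $x_i\in\{1,2\}$ and $\sum_i x_i=n$; the rank of such $w$ is $n$, and $F=\coprod_{n\ge0}F(n)$ ($F(0)$ contains only the empty word $\emptyset$). The Young–Fibonacci graph has vertex set $F$, with an edge between $v\in F(n)$ and $w\in F(n+1)$ (written $v\in w^-$, $w\in v^+$) iff either (1) $v$ is obtained from $w$ by changing into a $1$ some $2$ of $w$ that has no $1$ to its left, or (2) $v$ is obtained from $w$ by removing its leftmost $1$. The $f$-statistic is defined by $f_\emptyset=1$ and $f_w=\sum_{v\in w^- }f_v$. A word $w$ is odd if $f_w$ is odd; $F_{\mathrm{odd}}(n)$ denotes the set of odd words in $F(n)$, and $F_{\mathrm{odd}}$ the subgraph of the Young–Fibonacci graph induced by all odd words. Children of a node of rank $n$ are its neighbours of rank $n+1$. -}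

module Defs where

open import Data.Nat using (ℕ; zero; suc; _+_; _%_)
open import Data.List using (List; []; _∷_; _++_; map)
open import Data.Nat.ListAction using (sum)
open import Data.List.Relation.Unary.All using (All)
open import Data.Product using (Σ; _×_; ∃; ∃-syntax)
open import Data.Sum using (_⊎_)
open import Relation.Binary.PropositionalEquality using (_≡_)

data Letter : Set where
  one two : Letter

Word : Set
Word = List Letter

val : Letter → ℕ
val one = 1
val two = 2

rank : Word → ℕ
rank [] = 0
rank (x ∷ w) = val x + rank w

-- v ⋖ w  means  v ∈ w⁻  (equivalently w ∈ v⁺), literally as in the paper:
-- (1) v is obtained from w by changing into a 1 some 2 of w with no 1 to its left
--     (the prefix before that 2 consists only of 2s);
-- (2) v is obtained from w by removing its leftmost 1
--     (the prefix before that 1 consists only of 2s).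
_⋖_ : Word → Word → Set
v ⋖ w =
  (∃[ p ] ∃[ s ] (All (_≡ two) p × w ≡ p ++ (two ∷ s) × v ≡ p ++ (one ∷ s)))
  ⊎ (∃[ p ] ∃[ s ] (All (_≡ two) p × w ≡ p ++ (one ∷ s) × v ≡ p ++ s))

-- The list of all elements of w⁻ (each exactly once), computed recursively:
-- for 1w the only lower neighbour is w; for 2w they are 1w and 2v for v ∈ w⁻.
down : Word → List Word
down [] = []
down (one ∷ w) = w ∷ []
down (two ∷ w) = (one ∷ w) ∷ map (two ∷_) (down w)

-- f-statistic: f ∅ = 1, f w = Σ_{v ∈ w⁻} f v  (fuel = rank, each step lowers rank by 1)
fAux : ℕ → Word → ℕ
fAux zero _ = 1
fAux (suc k) w = sum (map (fAux k) (down w))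

f : Word → ℕ
f w = fAux (rank w) w

IsOdd : Word → Set
IsOdd w = f w % 2 ≡ 1

-- The f-statistic satisfies f(1w) = f(w) and f(2w) = (rank w + 1) f(w), so w is odd exactly
-- when every 2 in w is followed by a suffix of even rank. An edge v ⋖ u acting behind a nonempty
-- prefix 22…2 would then force both rank s and rank s + 1 to be even, s being the suffix after
-- the edited letter. Hence edges between odd words only touch the first letter (u = 1v, or
-- v = 1s and u = 2s), and the parity of the rank decides which of the two occur.
module Submission where

open import Defs
open import Data.Nat using (ℕ; zero; suc; _+_; _*_; _%_; _∸_; parity)
open import Data.Nat.Properties using (suc-injective; +-identityʳ; *-zeroʳ; *-distribˡ-+)
open import Data.Nat.ListAction using (sum)
open import Data.Parity.Base using (Parity; 0ℙ; 1ℙ)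
open import Data.Parity.Properties using (+-homo-+; *-homo-*)
open import Data.List using ([]; _∷_; _++_; map)
open import Data.List.Properties using (map-∘)
open import Data.List.Relation.Unary.All as All using (All; []; _∷_)
open import Data.List.Relation.Unary.All.Properties using (map⁺)
open import Data.Product using (Σ; _×_; _,_; proj₁; proj₂; ∃-syntax)
open import Data.Sum using (_⊎_; inj₁; inj₂)
open import Data.Empty using (⊥; ⊥-elim)
open import Function using (_∘_; case_of_)
open import Function.Bundles using (_⇔_; mk⇔; Equivalence)
open import Relation.Binary.PropositionalEquality
  using (_≡_; refl; sym; trans; cong; cong₂; subst; module ≡-Reasoning)
open ≡-Reasoning

open Equivalence using (to; from)

private
  variable
    u v v′ w : Word

bit : Parity → ℕ
bit 0ℙ = 0
bit 1ℙ = 1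

%2≡bit-parity : ∀ n → n % 2 ≡ bit (parity n)
%2≡bit-parity zero = refl
%2≡bit-parity (suc zero) = refl
%2≡bit-parity (suc (suc n)) = %2≡bit-parity n

suc%2≡1⇔%2≡0 : ∀ n → suc n % 2 ≡ 1 ⇔ n % 2 ≡ 0
suc%2≡1⇔%2≡0 zero = mk⇔ (λ _ → refl) (λ _ → refl)
suc%2≡1⇔%2≡0 (suc zero) = mk⇔ (λ ()) (λ ())
suc%2≡1⇔%2≡0 (suc (suc n)) = suc%2≡1⇔%2≡0 n

%2≡0⇒suc%2≢0 : ∀ n → n % 2 ≡ 0 → suc n % 2 ≡ 0 → ⊥
%2≡0⇒suc%2≢0 n even even-suc with () ← trans (sym (from (suc%2≡1⇔%2≡0 n) even)) even-suc

suc*%2≡1⇔ : ∀ r x → (suc r * x) % 2 ≡ 1 ⇔ (r % 2 ≡ 0 × x % 2 ≡ 1)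
suc*%2≡1⇔ r x
  -- parity (1 + r) computes to (parity r)⁻¹
  rewrite %2≡bit-parity (suc r * x) | *-homo-* (suc r) x | +-homo-+ 1 r
        | %2≡bit-parity r | %2≡bit-parity x
  with parity r | parity x
... | 0ℙ | 1ℙ = mk⇔ (λ _ → refl , refl) (λ _ → refl)
... | 0ℙ | 0ℙ = mk⇔ (λ ()) (λ { (_ , ()) })
... | 1ℙ | _  = mk⇔ (λ ()) (λ { (() , _) })

sum-map-∝ : ∀ {A : Set} {g h : A → ℕ} c xs → All (λ x → g x ≡ c * h x) xs →
            sum (map g xs) ≡ c * sum (map h xs)
sum-map-∝ c [] [] = sym (*-zeroʳ c)
sum-map-∝ {g = g} {h} c (x ∷ xs) (gx≡ ∷ gxs≡) = begin
  g x + sum (map g xs)           ≡⟨ cong₂ _+_ gx≡ (sum-map-∝ c xs gxs≡) ⟩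
  c * h x + c * sum (map h xs)   ≡⟨ sym (*-distribˡ-+ c (h x) _) ⟩
  c * sum (map h (x ∷ xs))       ∎

rank-down : ∀ w → All (λ v → suc (rank v) ≡ rank w) (down w)
rank-down [] = []
rank-down (one ∷ w) = refl ∷ []
rank-down (two ∷ w) = refl ∷ map⁺ (All.map (cong (suc ∘ suc)) (rank-down w))

fAux-two∷ : ∀ k w → rank w ≡ k → fAux (2 + k) (two ∷ w) ≡ suc k * fAux k w
fAux-two∷ zero [] refl = refl
fAux-two∷ zero (one ∷ _) ()
fAux-two∷ zero (two ∷ _) ()
fAux-two∷ (suc k) w rank≡ = begin
  fAux (2 + k) (one ∷ w) + sum (map (fAux (2 + k)) (map (two ∷_) (down w)))
    ≡⟨ cong₂ _+_ (+-identityʳ _) (cong sum (sym (map-∘ (down w)))) ⟩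
  fAux (suc k) w + sum (map (fAux (2 + k) ∘ (two ∷_)) (down w))
    ≡⟨ cong (fAux (suc k) w +_) (sum-map-∝ (suc k) (down w) (All.map IH (rank-down w))) ⟩
  fAux (suc k) w + suc k * sum (map (fAux k) (down w))
    ∎
  where
  IH : ∀ {v} → suc (rank v) ≡ rank w → fAux (2 + k) (two ∷ v) ≡ suc k * fAux k v
  IH {v} e = fAux-two∷ k v (suc-injective (trans e rank≡))

f-one∷ : ∀ w → f (one ∷ w) ≡ f w
f-one∷ w = +-identityʳ (f w)

f-two∷ : ∀ w → f (two ∷ w) ≡ suc (rank w) * f w
f-two∷ w = fAux-two∷ (rank w) w refl

odd-one∷ : ∀ w → IsOdd (one ∷ w) ⇔ IsOdd w
odd-one∷ w = mk⇔ (subst OddValue (f-one∷ w)) (subst OddValue (sym (f-one∷ w)))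
  where
  OddValue : ℕ → Set
  OddValue m = m % 2 ≡ 1

odd-two∷ : ∀ w → IsOdd (two ∷ w) ⇔ (rank w % 2 ≡ 0 × IsOdd w)
odd-two∷ w = subst (λ m → m % 2 ≡ 1 ⇔ (rank w % 2 ≡ 0 × IsOdd w)) (sym (f-two∷ w))
                   (suc*%2≡1⇔ (rank w) (f w))

rank-twos++ : ∀ {p} s → All (_≡ two) p → rank (p ++ s) % 2 ≡ rank s % 2
rank-twos++ s [] = refl
rank-twos++ s (refl ∷ twos) = rank-twos++ s twos

odd-two∷twos++⇒even : ∀ {p} s → All (_≡ two) p → IsOdd (two ∷ p ++ s) → rank s % 2 ≡ 0
odd-two∷twos++⇒even {p} s twos odd =
  trans (sym (rank-twos++ s twos)) (proj₁ (to (odd-two∷ (p ++ s)) odd))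

w⋖one∷w : w ⋖ (one ∷ w)
w⋖one∷w {w} = inj₂ ([] , w , [] , refl , refl)

one∷w⋖two∷w : (one ∷ w) ⋖ (two ∷ w)
one∷w⋖two∷w {w} = inj₁ ([] , w , [] , refl , refl)

odd-⋖-at-head : v ⋖ u → IsOdd v → IsOdd u → (∃[ s ] (v ≡ one ∷ s × u ≡ two ∷ s)) ⊎ u ≡ one ∷ v
odd-⋖-at-head (inj₁ ([] , s , [] , refl , refl)) _ _ = inj₁ (s , refl , refl)
odd-⋖-at-head (inj₂ ([] , s , [] , refl , refl)) _ _ = inj₂ refl
odd-⋖-at-head (inj₁ (_ ∷ _ , s , refl ∷ twos , refl , refl)) odd-v odd-u =
  ⊥-elim (%2≡0⇒suc%2≢0 (rank s) (odd-two∷twos++⇒even (two ∷ s) twos odd-u)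
                                (odd-two∷twos++⇒even (one ∷ s) twos odd-v))
odd-⋖-at-head (inj₂ (_ ∷ _ , s , refl ∷ twos , refl , refl)) odd-v odd-u =
  ⊥-elim (%2≡0⇒suc%2≢0 (rank s) (odd-two∷twos++⇒even s twos odd-v)
                                (odd-two∷twos++⇒even (one ∷ s) twos odd-u))

odd-children-of-even-rank : ∀ w → rank w % 2 ≡ 0 → IsOdd w → ∀ u → (w ⋖ u × IsOdd u) ⇔ u ≡ one ∷ w
odd-children-of-even-rank w even odd-w u = mk⇔ odd-child⇒ ⇒odd-child
  where
  odd-child⇒ : w ⋖ u × IsOdd u → u ≡ one ∷ w
  odd-child⇒ (w⋖u , odd-u) with odd-⋖-at-head w⋖u odd-w odd-u
  ... | inj₁ (s , refl , refl) =
    ⊥-elim (%2≡0⇒suc%2≢0 (rank s) (proj₁ (to (odd-two∷ s) odd-u)) even)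
  ... | inj₂ u≡one∷w = u≡one∷w

  ⇒odd-child : u ≡ one ∷ w → w ⋖ u × IsOdd u
  ⇒odd-child refl = w⋖one∷w , from (odd-one∷ w) odd-w

odd-of-odd-rank-starts-with-one : ∀ w → rank w % 2 ≡ 1 → IsOdd w → ∃[ v ] w ≡ one ∷ v
odd-of-odd-rank-starts-with-one [] () _
odd-of-odd-rank-starts-with-one (one ∷ v) _ _ = v , refl
odd-of-odd-rank-starts-with-one (two ∷ w) odd-rank odd
  with () ← trans (sym (proj₁ (to (odd-two∷ w) odd))) odd-rank

odd-children-of-one∷ : ∀ v → rank v % 2 ≡ 0 → IsOdd v → ∀ u →
                       ((one ∷ v) ⋖ u × IsOdd u) ⇔ (u ≡ one ∷ one ∷ v ⊎ u ≡ two ∷ v)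
odd-children-of-one∷ v even odd-v u = mk⇔ odd-child⇒ ⇒odd-child
  where
  odd-one∷v : IsOdd (one ∷ v)
  odd-one∷v = from (odd-one∷ v) odd-v

  odd-child⇒ : (one ∷ v) ⋖ u × IsOdd u → u ≡ one ∷ one ∷ v ⊎ u ≡ two ∷ v
  odd-child⇒ (e , odd-u) with odd-⋖-at-head e odd-one∷v odd-u
  ... | inj₁ (_ , refl , refl) = inj₂ refl
  ... | inj₂ u≡one∷one∷v = inj₁ u≡one∷one∷v

  ⇒odd-child : u ≡ one ∷ one ∷ v ⊎ u ≡ two ∷ v → (one ∷ v) ⋖ u × IsOdd u
  ⇒odd-child (inj₁ refl) = w⋖one∷w , from (odd-one∷ (one ∷ v)) odd-one∷v
  ⇒odd-child (inj₂ refl) = one∷w⋖two∷w , from (odd-two∷ v) (even , odd-v)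

odd-parent-unique : v ⋖ u → v′ ⋖ u → IsOdd v → IsOdd v′ → IsOdd u → v′ ≡ v
odd-parent-unique e e′ odd-v odd-v′ odd-u
  with odd-⋖-at-head e odd-v odd-u | odd-⋖-at-head e′ odd-v′ odd-u
... | inj₁ (_ , refl , refl) | inj₁ (_ , refl , refl) = refl
... | inj₁ (_ , refl , refl) | inj₂ ()
... | inj₂ refl              | inj₁ (_ , _ , ())
... | inj₂ refl              | inj₂ refl = refl

odd-parent : ∀ x w → IsOdd (x ∷ w) → ∃[ v ] (v ⋖ (x ∷ w) × IsOdd v)
odd-parent one w odd = w , w⋖one∷w , to (odd-one∷ w) odd
odd-parent two w odd = one ∷ w , one∷w⋖two∷w , from (odd-one∷ w) (proj₂ (to (odd-two∷ w) odd))

mainTheorem4 : ((n : ℕ) → n % 2 ≡ 0 → (w : Word) → rank w ≡ n → IsOdd w →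
      (u : Word) → (w ⋖ u × IsOdd u) ⇔ (u ≡ one ∷ w))
    × ((n : ℕ) → n % 2 ≡ 1 → (w : Word) → rank w ≡ n → IsOdd w →
      Σ Word (λ v →
        ((rank v ≡ n ∸ 1 × IsOdd v × w ≡ one ∷ v)
          × ((v′ : Word) → rank v′ ≡ n ∸ 1 × IsOdd v′ × w ≡ one ∷ v′ → v′ ≡ v))
        × ((u : Word) → (w ⋖ u × IsOdd u) ⇔ (u ≡ one ∷ one ∷ v ⊎ u ≡ two ∷ v))))
    × ((w : Word) → rank w ≡ 0 → IsOdd w × w ≡ [])
    × ((n : ℕ) → (u : Word) → rank u ≡ suc n → IsOdd u →
      Σ Word (λ v → (v ⋖ u × IsOdd v) × ((v′ : Word) → v′ ⋖ u × IsOdd v′ → v′ ≡ v)))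
mainTheorem4 =
    (λ { _ even w refl odd → odd-children-of-even-rank w even odd })
  , (λ { _ odd-rank w refl odd → case odd-of-odd-rank-starts-with-one w odd-rank odd of λ
         { (v , refl) →
             let even = to (suc%2≡1⇔%2≡0 (rank v)) odd-rank
                 odd-v = to (odd-one∷ v) odd
             in v , ((refl , odd-v , refl) , λ { _ (_ , _ , refl) → refl })
                  , odd-children-of-one∷ v even odd-v } })
  , (λ { [] _ → refl , refl ; (one ∷ _) () ; (two ∷ _) () })
  , (λ { _ [] () _
       ; _ (x ∷ w) _ odd → case odd-parent x w odd of λ
           { (v , v⋖u , odd-v) → v , (v⋖u , odd-v)
                               , λ v′ (v′⋖u , odd-v′) → odd-parent-unique v⋖u v′⋖u odd-v odd-v′ odd } })
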